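{- Let $G$ be a graph. Then $\mathcal{Z}(G;x)=\mathcal{P}(G;x)$ if and only if $G$ is isomorphic to a disjoint union $P_{a_1}\,\dot\cup\,\cdots\,\dot\cup\, P_{a_k}$ of paths with $a_i\le 2$ for all $1\le i\le k$.
   Context: Graphs are finite and simple with nonempty vertex set; $n$ is the number of vertices and $P_a$ is the path on $a$ vertices. For $S\subseteq V(G)$: $S$ is a power dominating set if, after coloring $S$, coloring every neighbor of a vertex of $S$ (domination step), and then repeatedly applying the forcing rule (a colored vertex with exactly one uncolored neighbor colors that neighbor) until no changes occur, all vertices are colored. $S$ is a zero forcing set if coloring $S$ and applying only the forcing rule repeatedly colors all vertices. $\mathcal{P}(G;x)=\sum_{i=1}^n p(G;i)x^i$ and $\mathcal{Z}(G;x)=\sum_{i=1}^n z(G;i)x^i$, where $p(G;i)$ and $z(G;i)$ are the numbers of power dominating sets and zero forcing sets of $G$ of size $i$. -}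

module Defs where

open import Data.Bool.Properties using (∨-comm)
open import Data.Bool using (Bool; true; false; _∧_; _∨_; not; if_then_else_)
open import Data.Nat using (ℕ; zero; suc; _+_; _≡ᵇ_)
open import Data.Fin using (Fin; zero; suc; toℕ; splitAt; _≟_)
open import Data.List using (List; []; _∷_; allFin; length; filterᵇ; map; _++_)
open import Data.Bool.ListAction using (any; all)
open import Data.Nat.ListAction using (sum)
open import Data.Sum using (inj₁; inj₂)
open import Data.Product using (Σ; _×_)
open import Relation.Nullary using (does)
open import Relation.Binary.PropositionalEquality using (_≡_; refl; cong₂)
open import Function.Bundles using (_↔_; Inverse)

record Graph (n : ℕ) : Set where
  field
    adj   : Fin n → Fin n → Bool
    sym   : ∀ i j → adj i j ≡ adj j i
    irrefl : ∀ i → adj i i ≡ false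
open Graph public

Coloring : ℕ → Set
Coloring n = Fin n → Bool

module _ {n : ℕ} (G : Graph n) where

  -- v gets forced in coloring c: some coloured u adjacent to v has every
  -- neighbour other than v already coloured (so v is its unique uncoloured
  -- neighbour, or v is already coloured).
  forceStep : Coloring n → Coloring n
  forceStep c v = c v ∨ any (λ u → c u ∧ adj G u v ∧
                      all (λ w → does (w ≟ v) ∨ not (adj G u w) ∨ c w) (allFin n))
                    (allFin n)

  iterate : ℕ → Coloring n → Coloring n
  iterate zero    c = c
  iterate (suc k) c = iterate k (forceStep c)

  -- Result of applying the forcing rule until no change occurs.
  -- (Each productive round colours at least one new vertex, and forcing is
  -- monotone, so n parallel rounds reach the unique final coloring.)
  forceClosure : Coloring n → Coloring n
  forceClosure = iterate n

  dominate : Coloring n → Coloring n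
  dominate c v = c v ∨ any (λ u → c u ∧ adj G u v) (allFin n)

  allColored : Coloring n → Bool
  allColored c = all c (allFin n)

  isZeroForcing : Coloring n → Bool
  isZeroForcing S = allColored (forceClosure S)

  isPowerDominating : Coloring n → Bool
  isPowerDominating S = allColored (forceClosure (dominate S))

-- All subsets of Fin n, each exactly once.
allSubsets : ∀ n → List (Coloring n)
allSubsets zero    = (λ ()) ∷ []
allSubsets (suc n) = map (λ c → extend false c) (allSubsets n)
                  ++ map (λ c → extend true c) (allSubsets n)
  where
  extend : Bool → Coloring n → Coloring (suc n)
  extend b c zero    = b
  extend b c (suc i) = c i

size : ∀ {n} → Coloring n → ℕ
size {n} S = length (filterᵇ S (allFin n))

p : ∀ {n} → Graph n → ℕ → ℕ
p {n} G i = length (filterᵇ (λ S → isPowerDominating G S ∧ (size S ≡ᵇ i)) (allSubsets n))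

z : ∀ {n} → Graph n → ℕ → ℕ
z {n} G i = length (filterᵇ (λ S → isZeroForcing G S ∧ (size S ≡ᵇ i)) (allSubsets n))

pathAdj : ∀ a → Fin a → Fin a → Bool
pathAdj a i j = (suc (toℕ i) ≡ᵇ toℕ j) ∨ (suc (toℕ j) ≡ᵇ toℕ i)

private
  sk≢k : ∀ k → (suc k ≡ᵇ k) ≡ false
  sk≢k zero    = refl
  sk≢k (suc k) = sk≢k k

P : (a : ℕ) → Graph a
P a = record
  { adj    = pathAdj a
  ; sym    = λ i j → ∨-comm (suc (toℕ i) ≡ᵇ toℕ j) (suc (toℕ j) ≡ᵇ toℕ i)
  ; irrefl = λ i → cong₂ _∨_ (sk≢k (toℕ i)) (sk≢k (toℕ i))
  }

-- Disjoint union of two graphs (vertices of G first, then H).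
_⊍_ : ∀ {m n} → Graph m → Graph n → Graph (m + n)
_⊍_ {m} {n} G H = record { adj = A ; sym = S ; irrefl = I }
  where
  A : Fin (m + n) → Fin (m + n) → Bool
  A i j with splitAt m i | splitAt m j
  ... | inj₁ x | inj₁ y = adj G x y
  ... | inj₂ x | inj₂ y = adj H x y
  ... | _      | _      = false
  S : ∀ i j → A i j ≡ A j i
  S i j with splitAt m i | splitAt m j
  ... | inj₁ x | inj₁ y = sym G x y
  ... | inj₂ x | inj₂ y = sym H x y
  ... | inj₁ x | inj₂ y = refl
  ... | inj₂ x | inj₁ y = refl
  I : ∀ i → A i i ≡ false
  I i with splitAt m i
  ... | inj₁ x = irrefl G x
  ... | inj₂ x = irrefl H x

K0 : Graph 0
K0 = record { adj = λ () ; sym = λ () ; irrefl = λ () }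

pathsUnion : (as : List ℕ) → Graph (sum as)
pathsUnion []       = K0
pathsUnion (a ∷ as) = P a ⊍ pathsUnion as

_≅_ : ∀ {m n} → Graph m → Graph n → Set
_≅_ {m} {n} G H = Σ (Fin m ↔ Fin n) λ f →
  ∀ i j → adj G i j ≡ adj H (Inverse.to f i) (Inverse.to f j)

module Submission where

-- Every zero forcing set is power dominating, so the polynomials agree iff
-- every power dominating set is zero forcing (counting sets of each size; a
-- power dominating set is nonempty).  We show that this happens iff G has
-- maximum degree at most one, which in turn holds iff G is a disjoint union
-- of copies of P 1 and P 2.
--  * Maximum degree ≤ 1: a coloured vertex forces its unique neighbour, so
--    domination adds nothing that the first forcing round does not.
--  * Conversely we use forts (nonempty sets that no outside vertex has
--    exactly one neighbour in): a set missing a fort is not zero forcing, and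
--    the uncoloured part of an incomplete final colouring is a fort.  If power
--    domination gains nothing, every fort contains a nonempty union of
--    components; a vertex v with two neighbours then lets us grow unions of
--    components avoiding v beyond n vertices, a contradiction.
--  * A graph of maximum degree ≤ 1 splits off the component of vertex 0 as
--    P 1 or P 2, and the rest is decomposed recursively.

open import Defs hiding (sym)
open import Data.Bool using (Bool; true; false; T; not; _∧_; _∨_)
open import Data.Bool.Properties using (T-∧; T-∨; T-≡)
open import Data.Bool.ListAction using (any; all)
open import Data.Empty using (⊥; ⊥-elim)
import Data.Fin as Fin
open import Data.Fin using (Fin; zero; suc; _≟_; splitAt; join; punchIn; punchOut)
open import Data.Fin.Properties
  using (any?; ¬∀⟶∃¬; +↔⊎; splitAt-join; suc-injective; punchIn-injective; punchInᵢ≢i; punchIn-punchOut; punchOut-punchIn; punchOut-cong)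
open import Data.List using (List; []; _∷_; length; filterᵇ; allFin)
open import Data.List.Membership.Propositional using (lose)
open import Data.List.Membership.Propositional.Properties using (∈-allFin)
open import Data.List.Properties using (filter-all; length-tabulate)
open import Data.List.Relation.Unary.All using (All; []; _∷_; universal)
import Data.List.Relation.Unary.All as All
open import Data.List.Relation.Unary.All.Properties using (all⁺; all⁻)
open import Data.List.Relation.Unary.Any using (Any; here; there; satisfied)
open import Data.List.Relation.Unary.Any.Properties using (any⁺; any⁻; map⁺; ++⁺ˡ; ++⁺ʳ)
import Data.List.Relation.Unary.Any as Any
open import Data.Nat using (ℕ; zero; suc; _+_; _≤_; _<_; z≤n; s≤s; _≡ᵇ_)
open import Data.Nat.Properties using (≤-trans; <-≤-trans; m≤n⇒m≤1+n; ≤-reflexive; <-irrefl; n<1+n; ≤-antisym; ≡⇒≡ᵇ)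
open import Data.Product using (Σ; ∃-syntax; _×_; _,_; proj₁; proj₂)
open import Data.Sum using (_⊎_; inj₁; inj₂; [_,_])
import Data.Sum as Sum
open import Data.Sum.Function.Propositional using (_⊎-↔_)
open import Function using (_∘_)
open import Function.Bundles using (Equivalence; Injection; Inverse; _↔_; mk↔ₛ′; _⇔_; mk⇔)
open import Function.Properties.Inverse using (↔-refl; ↔-trans; ↔-sym; Inverse⇒Injection)
open import Relation.Binary.PropositionalEquality using (_≡_; _≢_; _≗_; refl; sym; trans; cong; cong₂; subst; module ≡-Reasoning)
open import Relation.Nullary using (¬_; yes; no; does; contradiction)
open import Relation.Nullary.Decidable using (T?; decidable-stable; _×-dec_; ¬?)

module _ {n : ℕ} (p : Fin n → Bool) where

  any-allFin⁺ : ∀ x → T (p x) → T (any p (allFin n))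
  any-allFin⁺ x px = any⁺ p (lose (∈-allFin x) px)

  any-allFin⁻ : T (any p (allFin n)) → ∃[ x ] T (p x)
  any-allFin⁻ h = satisfied (any⁻ p (allFin n) h)

  all-allFin⁺ : (∀ x → T (p x)) → T (all p (allFin n))
  all-allFin⁺ h = all⁻ p (universal h (allFin n))

  all-allFin⁻ : T (all p (allFin n)) → ∀ x → T (p x)
  all-allFin⁻ h x = All.lookup (all⁺ p (allFin n) h) (∈-allFin x)

module _ {A : Set} {p q : A → Bool} (p⇒q : ∀ x → T (p x) → T (q x)) where

  count-mono : ∀ xs → length (filterᵇ p xs) ≤ length (filterᵇ q xs)
  count-mono [] = z≤n
  count-mono (x ∷ xs) with p x | q x | p⇒q x
  ... | true  | true  | _   = s≤s (count-mono xs)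
  ... | true  | false | p⇒qx = ⊥-elim (p⇒qx _)
  ... | false | true  | _   = m≤n⇒m≤1+n (count-mono xs)
  ... | false | false | _   = count-mono xs

  count-strict : ∀ {xs} → Any (λ x → ¬ T (p x) × T (q x)) xs →
                 length (filterᵇ p xs) < length (filterᵇ q xs)
  count-strict {x ∷ xs} (here (¬px , qx)) with p x | q x
  ... | true  | _    = contradiction _ ¬px
  ... | false | true = s≤s (count-mono xs)
  count-strict {x ∷ xs} (there more) with p x | q x | p⇒q x
  ... | true  | true  | _   = s≤s (count-strict more)
  ... | true  | false | p⇒qx = ⊥-elim (p⇒qx _)
  ... | false | true  | _   = m≤n⇒m≤1+n (count-strict more)
  ... | false | false | _   = count-strict more

infix 4 _⊆_
_⊆_ : ∀ {n} → Coloring n → Coloring n → Set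
c ⊆ d = ∀ x → T (c x) → T (d x)

⊆-trans : ∀ {n} {c d e : Coloring n} → c ⊆ d → d ⊆ e → c ⊆ e
⊆-trans c⊆d d⊆e x = d⊆e x ∘ c⊆d x

infixr 6 _∪_
_∪_ : ∀ {n} → Coloring n → Coloring n → Coloring n
(c ∪ d) x = c x ∨ d x

∪⁺ : ∀ {n} (c d : Coloring n) x → T (c x) ⊎ T (d x) → T ((c ∪ d) x)
∪⁺ c d x = Equivalence.from T-∨

∪⁻ : ∀ {n} (c d : Coloring n) x → T ((c ∪ d) x) → T (c x) ⊎ T (d x)
∪⁻ c d x = Equivalence.to T-∨

T-not⁺ : ∀ {b} → ¬ T b → T (not b)
T-not⁺ {false} _ = _
T-not⁺ {true}  ¬b = ¬b _

T-not⁻ : ∀ {b} → T (not b) → ¬ T b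
T-not⁻ {false} _ ()

¬T⇒false : ∀ {b} → ¬ T b → b ≡ false
¬T⇒false {false} _  = refl
¬T⇒false {true}  ¬b = contradiction _ ¬b

⊆-or-witness : ∀ {n} (c d : Coloring n) → c ⊆ d ⊎ ∃[ x ] T (c x) × ¬ T (d x)
⊆-or-witness c d with any? (λ x → T? (c x) ×-dec ¬? (T? (d x)))
... | yes witness = inj₂ witness
... | no  none    = inj₁ λ x cx → decidable-stable (T? (d x)) λ ¬dx → none (x , cx , ¬dx)

module _ {n : ℕ} where

  size-≤ : (c : Coloring n) → size c ≤ n
  size-≤ c = ≤-trans (count-mono (λ _ _ → _) (allFin n)) (≤-reflexive full-size)
    where
    full-size : length (filterᵇ (λ _ → true) (allFin n)) ≡ n
    full-size = trans (cong length (filter-all _ (universal _ (allFin n)))) (length-tabulate _)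

  size-mono : {c d : Coloring n} → c ⊆ d → size c ≤ size d
  size-mono c⊆d = count-mono c⊆d (allFin n)

  size-strict : {c d : Coloring n} → c ⊆ d → ∀ x → ¬ T (c x) → T (d x) → size c < size d
  size-strict c⊆d x ¬cx dx = count-strict c⊆d (lose (∈-allFin x) (¬cx , dx))

  size-full : (c : Coloring n) → n ≤ size c → ∀ x → T (c x)
  size-full c n≤size x = decidable-stable (T? (c x)) λ ¬cx →
    <-irrefl refl (≤-trans (s≤s n≤size) (≤-trans (size-strict (λ _ _ → _) x ¬cx _) (size-≤ (λ _ → true))))

adj-sym : ∀ {n} (G : Graph n) {x y} → T (adj G x y) → T (adj G y x)
adj-sym G {x} {y} = subst T (Graph.sym G x y)

adj-irrefl : ∀ {n} (G : Graph n) {x} → ¬ T (adj G x x)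
adj-irrefl G {x} = subst T (irrefl G x)

MaxDegree≤1 : ∀ {n} → Graph n → Set
MaxDegree≤1 G = ∀ v u w → T (adj G v u) → T (adj G v w) → u ≡ w

module Forcing {n : ℕ} (G : Graph n) where

  Adj : Fin n → Fin n → Set
  Adj x y = T (adj G x y)

  Forces : Coloring n → Fin n → Fin n → Set
  Forces c u v = T (c u) × Adj u v × (∀ w → w ≢ v → Adj u w → T (c w))

  forceStep⁺ : ∀ {c v} → T (c v) ⊎ ∃[ u ] Forces c u v → T (forceStep G c v)
  forceStep⁻ : ∀ {c v} → T (forceStep G c v) → T (c v) ⊎ ∃[ u ] Forces c u v
  dominate⁺ : ∀ {c v} → T (c v) ⊎ ∃[ u ] T (c u) × Adj u v → T (dominate G c v)
  dominate⁻ : ∀ {c v} → T (dominate G c v) → T (c v) ⊎ ∃[ u ] T (c u) × Adj u v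

  private
    othersColoured⁺ : ∀ c u v w → (w ≢ v → Adj u w → T (c w)) →
                      T (does (w ≟ v) ∨ not (adj G u w) ∨ c w)
    othersColoured⁺ c u v w h with w ≟ v | adj G u w
    ... | yes _   | _     = _
    ... | no _    | false = _
    ... | no w≢v  | true  = h w≢v _

    othersColoured⁻ : ∀ c u v w → T (does (w ≟ v) ∨ not (adj G u w) ∨ c w) →
                      w ≢ v → Adj u w → T (c w)
    othersColoured⁻ c u v w h w≢v with w ≟ v | adj G u w
    ... | yes w≡v | _    = contradiction w≡v w≢v
    ... | no _    | true = λ _ → h

  forceStep⁺ (inj₁ cv) = Equivalence.from T-∨ (inj₁ cv)
  forceStep⁺ {c} {v} (inj₂ (u , cu , uv , others)) =
    Equivalence.from T-∨ (inj₂ (any-allFin⁺ _ u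
      (Equivalence.from T-∧ (cu , Equivalence.from T-∧ (uv ,
        all-allFin⁺ _ λ w → othersColoured⁺ c u v w (others w))))))

  forceStep⁻ {c} {v} h with Equivalence.to T-∨ h
  ... | inj₁ cv = inj₁ cv
  ... | inj₂ some with any-allFin⁻ _ some
  ... | u , forcing with Equivalence.to T-∧ forcing
  ... | cu , rest with Equivalence.to T-∧ rest
  ... | uv , others =
    inj₂ (u , cu , uv , λ w → othersColoured⁻ c u v w (all-allFin⁻ _ others w))

  dominate⁺ (inj₁ cv) = Equivalence.from T-∨ (inj₁ cv)
  dominate⁺ (inj₂ (u , cu , uv)) =
    Equivalence.from T-∨ (inj₂ (any-allFin⁺ _ u (Equivalence.from T-∧ (cu , uv))))

  dominate⁻ h with Equivalence.to T-∨ h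
  ... | inj₁ cv = inj₁ cv
  ... | inj₂ some with any-allFin⁻ _ some
  ... | u , cu∧uv = inj₂ (u , Equivalence.to T-∧ cu∧uv)

  allColored⁺ : ∀ {c} → (∀ x → T (c x)) → T (allColored G c)
  allColored⁺ = all-allFin⁺ _

  allColored⁻ : ∀ {c} → T (allColored G c) → ∀ x → T (c x)
  allColored⁻ = all-allFin⁻ _

  forceStep-ext : ∀ c → c ⊆ forceStep G c
  forceStep-ext c x cx = forceStep⁺ {c} (inj₁ cx)

  forceStep-mono : ∀ {c d} → c ⊆ d → forceStep G c ⊆ forceStep G d
  forceStep-mono {c} {d} c⊆d v h with forceStep⁻ {c} h
  ... | inj₁ cv = forceStep⁺ {d} (inj₁ (c⊆d v cv))
  ... | inj₂ (u , cu , uv , others) =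
    forceStep⁺ {d} (inj₂ (u , c⊆d u cu , uv , λ w w≢v uw → c⊆d w (others w w≢v uw)))

  dominate-ext : ∀ c → c ⊆ dominate G c
  dominate-ext c x cx = dominate⁺ {c} (inj₁ cx)

  dominate-mono : ∀ {c d} → c ⊆ d → dominate G c ⊆ dominate G d
  dominate-mono {c} {d} c⊆d v h with dominate⁻ {c} h
  ... | inj₁ cv = dominate⁺ {d} (inj₁ (c⊆d v cv))
  ... | inj₂ (u , cu , uv) = dominate⁺ {d} (inj₂ (u , c⊆d u cu , uv))

  iterate-ext : ∀ k c → c ⊆ iterate G k c
  iterate-ext zero    c = λ _ cx → cx
  iterate-ext (suc k) c = ⊆-trans (forceStep-ext c) (iterate-ext k (forceStep G c))

  iterate-mono : ∀ k {c d} → c ⊆ d → iterate G k c ⊆ iterate G k d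
  iterate-mono zero    c⊆d = c⊆d
  iterate-mono (suc k) c⊆d = iterate-mono k (forceStep-mono c⊆d)

  iterate-suc : ∀ k c → iterate G (suc k) c ≡ forceStep G (iterate G k c)
  iterate-suc zero    c = refl
  iterate-suc (suc k) c = iterate-suc k (forceStep G c)

  Stable : Coloring n → Set
  Stable c = forceStep G c ⊆ c

  progress-step : ∀ {k} X → k ≤ size X ⊎ Stable X →
                  suc k ≤ size (forceStep G X) ⊎ Stable (forceStep G X)
  progress-step X (inj₂ stable) = inj₂ (forceStep-mono stable)
  progress-step X (inj₁ k≤size) with ⊆-or-witness (forceStep G X) X
  ... | inj₁ stable          = inj₂ (forceStep-mono stable)
  ... | inj₂ (x , fx , ¬Xx) = inj₁ (≤-trans (s≤s k≤size) (size-strict (forceStep-ext X) x ¬Xx fx))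

  progress : ∀ c k → k ≤ size (iterate G k c) ⊎ Stable (iterate G k c)
  progress c zero    = inj₁ z≤n
  progress c (suc k) = subst (λ X → suc k ≤ size X ⊎ Stable X) (sym (iterate-suc k c))
                         (progress-step (iterate G k c) (progress c k))

  closure-stable : ∀ c → Stable (forceClosure G c)
  closure-stable c with progress c n
  ... | inj₁ n≤size = λ x _ → size-full _ n≤size x
  ... | inj₂ stable = stable

  zf⇒pd : ∀ S → T (isZeroForcing G S) → T (isPowerDominating G S)
  zf⇒pd S zf = allColored⁺ λ x → iterate-mono n (dominate-ext S) x (allColored⁻ zf x)

  zf-mono : ∀ {S S'} → S ⊆ S' → T (isZeroForcing G S) → T (isZeroForcing G S')
  zf-mono S⊆S' zf = allColored⁺ λ x → iterate-mono n S⊆S' x (allColored⁻ zf x)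

  pd-mono : ∀ {S S'} → S ⊆ S' → T (isPowerDominating G S) → T (isPowerDominating G S')
  pd-mono S⊆S' pd = allColored⁺ λ x → iterate-mono n (dominate-mono S⊆S') x (allColored⁻ pd x)

  -- With maximum degree at most one, a coloured vertex has no neighbour
  -- other than the one it dominates, so it forces that neighbour: domination
  -- is part of the first forcing round, and power domination gains nothing.
  dominate⊆forceStep : MaxDegree≤1 G → ∀ c → dominate G c ⊆ forceStep G c
  dominate⊆forceStep deg c v h with dominate⁻ {c} h
  ... | inj₁ cv         = forceStep⁺ {c} (inj₁ cv)
  ... | inj₂ (u , cu , uv) =
    forceStep⁺ {c} (inj₂ (u , cu , uv , λ w w≢v uw → contradiction (deg u w v uw uv) w≢v))

  max-degree≤1⇒pd⇒zf : MaxDegree≤1 G → ∀ S → T (isPowerDominating G S) → T (isZeroForcing G S)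
  max-degree≤1⇒pd⇒zf deg S pd = allColored⁺ λ x → closure⊆ x (allColored⁻ pd x)
    where
    -- n rounds after domination do no more than n+1 rounds, i.e. than n rounds
    closure⊆ : forceClosure G (dominate G S) ⊆ forceClosure G S
    closure⊆ = ⊆-trans (iterate-mono n (dominate⊆forceStep deg S))
                 (subst (_⊆ forceClosure G S) (sym (iterate-suc n S)) (closure-stable S))

module Forts {n : ℕ} (G : Graph n) where
  open Forcing G

  record Fort (F : Coloring n) : Set where
    field
      member   : Fin n
      member∈F : T (F member)
      guarded  : ∀ {y x} → ¬ T (F y) → T (F x) → Adj y x → ∃[ w ] w ≢ x × Adj y w × T (F w)
  open Fort

  Disjoint : Coloring n → Coloring n → Set
  Disjoint c F = ∀ x → T (c x) → ¬ T (F x)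

  -- Forcing never enters a fort that is initially uncoloured: a coloured
  -- neighbour of the fort always sees at least two uncoloured fort vertices.
  fort-blocks-step : ∀ {F c} → Fort F → Disjoint c F → Disjoint (forceStep G c) F
  fort-blocks-step {F} {c} fort c∩F x h Fx with forceStep⁻ {c} h
  ... | inj₁ cx = c∩F x cx Fx
  ... | inj₂ (u , cu , ux , others) with guarded fort (c∩F u cu) Fx ux
  ... | w , w≢x , uw , Fw = c∩F w (others w w≢x uw) Fw

  fort-blocks-iterate : ∀ k {F c} → Fort F → Disjoint c F → Disjoint (iterate G k c) F
  fort-blocks-iterate zero    fort c∩F = c∩F
  fort-blocks-iterate (suc k) fort c∩F = fort-blocks-iterate k fort (fort-blocks-step fort c∩F)

  fort-not-zf : ∀ {F S} → Fort F → Disjoint S F → ¬ T (isZeroForcing G S)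
  fort-not-zf fort S∩F zf =
    fort-blocks-iterate n fort S∩F (member fort) (allColored⁻ zf (member fort)) (member∈F fort)

  -- Conversely, the uncoloured part of an incomplete final colouring is a
  -- fort: a coloured vertex with a single uncoloured neighbour would force it.
  closure-complement-fort : ∀ c → ¬ T (allColored G (forceClosure G c)) →
                            Fort (not ∘ forceClosure G c)
  closure-complement-fort c incomplete = record
    { member = proj₁ uncoloured ; member∈F = T-not⁺ (proj₂ uncoloured) ; guarded = guard }
    where
    d : Coloring n
    d = forceClosure G c
    uncoloured : ∃[ x ] ¬ T (d x)
    uncoloured = ¬∀⟶∃¬ n _ (λ x → T? (d x)) (incomplete ∘ allColored⁺)
    coloured : ∀ {y} → ¬ T (not (d y)) → T (d y)
    coloured {y} ¬dy = decidable-stable (T? (d y)) (¬dy ∘ T-not⁺)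
    guard : ∀ {y x} → ¬ T (not (d y)) → T (not (d x)) → Adj y x →
            ∃[ w ] w ≢ x × Adj y w × T (not (d w))
    guard {y} {x} ¬dy dx yx with any? (λ w → ¬? (w ≟ x) ×-dec T? (adj G y w) ×-dec T? (not (d w)))
    ... | yes other = other
    ... | no  none  = contradiction (closure-stable c x (forceStep⁺ {d} (inj₂ (y , coloured ¬dy , yx , others))))
                                    (T-not⁻ dx)
      where
      others : ∀ w → w ≢ x → Adj y w → T (d w)
      others w w≢x yw = decidable-stable (T? (d w)) λ ¬dw → none (w , w≢x , yw , T-not⁺ ¬dw)

  -- A closed set contains every neighbour of its members, i.e. it is a union
  -- of connected components.
  Closed : Coloring n → Set
  Closed Y = ∀ {x y} → T (Y x) → Adj x y → T (Y y)

  ∪-closed : ∀ {X Y} → Closed X → Closed Y → Closed (X ∪ Y)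
  ∪-closed {X} {Y} closedX closedY {x} {y} XYx xy with ∪⁻ X Y x XYx
  ... | inj₁ Xx = ∪⁺ X Y y (inj₁ (closedX Xx xy))
  ... | inj₂ Yx = ∪⁺ X Y y (inj₂ (closedY Yx xy))

module NoPowerDominationGain {n : ℕ} (G : Graph n)
    (pd⇒zf : ∀ S → T (isPowerDominating G S) → T (isZeroForcing G S)) where
  open Forcing G
  open Forts G
  open Fort

  NonEmpty : Coloring n → Set
  NonEmpty Y = ∃[ y ] T (Y y)

  -- The complement S of a fort F is not zero forcing, hence not power
  -- dominating, so the uncoloured part F' of its final colouring is again a
  -- fort.
  module Shrink (F : Coloring n) (fort : Fort F) where
    S d F' : Coloring n
    S x  = not (F x)
    d    = forceClosure G (dominate G S)
    F' x = not (d x)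

    F'-fort : Fort F'
    F'-fort = closure-complement-fort (dominate G S)
                (fort-not-zf fort (λ x Sx → T-not⁻ Sx) ∘ pd⇒zf S)

    near-S-coloured : ∀ {x y} → x ≡ y ⊎ Adj x y → ¬ T (F y) → T (d x)
    near-S-coloured {x} {y} x≈y ¬Fy =
      iterate-ext n (dominate G S) x (dominate⁺ {S} (near x≈y))
      where
      near : x ≡ y ⊎ Adj x y → T (S x) ⊎ ∃[ u ] T (S u) × Adj u x
      near (inj₁ refl) = inj₁ (T-not⁺ ¬Fy)
      near (inj₂ xy)   = inj₂ (y , T-not⁺ ¬Fy , adj-sym G xy)

    F'⊆F : F' ⊆ F
    F'⊆F x F'x = decidable-stable (T? (F x)) (T-not⁻ F'x ∘ near-S-coloured (inj₁ refl))

    F'-neighbours : ∀ {x y} → T (F' x) → Adj x y → T (F y)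
    F'-neighbours {x} {y} F'x xy =
      decidable-stable (T? (F y)) (T-not⁻ F'x ∘ near-S-coloured (inj₂ xy))

  -- Every fort contains a nonempty closed set: either F ⊆ F', and then F is
  -- itself closed, or F' is a strictly smaller fort inside F.
  fort-contains-closed : ∀ F → Fort F → ∃[ Y ] Y ⊆ F × NonEmpty Y × Closed Y
  fort-contains-closed F = go (suc (size F)) F (n<1+n (size F))
    where
    go : ∀ k F → size F < k → Fort F → ∃[ Y ] Y ⊆ F × NonEmpty Y × Closed Y
    go (suc k) F (s≤s size<k) fort = step (⊆-or-witness F F')
      where
      open Shrink F fort
      step : F ⊆ F' ⊎ ∃[ x ] T (F x) × ¬ T (F' x) → ∃[ Y ] Y ⊆ F × NonEmpty Y × Closed Y
      step (inj₁ F⊆F') =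
        F , (λ _ Fx → Fx) , (member fort , member∈F fort) , λ Fx → F'-neighbours (F⊆F' _ Fx)
      step (inj₂ (x , Fx , ¬F'x)) =
        let Y , Y⊆F' , nonempty , closed = go k F' (<-≤-trans (size-strict F'⊆F x ¬F'x Fx) size<k) F'-fort
        in  Y , ⊆-trans Y⊆F' F'⊆F , nonempty , closed

  module _ {v u w : Fin n} (vu : Adj v u) (vw : Adj v w) (u≢w : u ≢ w) where

    Outside : Coloring n → Coloring n
    Outside X x = not (X x ∨ does (x ≟ v))

    outside⁺ : ∀ X x → ¬ T (X x) → x ≢ v → T (Outside X x)
    outside⁺ X x ¬Xx x≢v with X x | x ≟ v
    ... | true  | _        = ¬Xx _
    ... | false | yes x≡v = x≢v x≡v
    ... | false | no _    = _

    outside⁻ : ∀ X x → T (Outside X x) → ¬ T (X x) × x ≢ v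
    outside⁻ X x h with X x | x ≟ v
    ... | false | no x≢v = (λ ()) , x≢v

    -- For a closed set X avoiding v, the vertices outside X other than v form
    -- a fort: the only vertex outside it with a neighbour inside is v, which
    -- has the two neighbours u and w there.
    outside-fort : ∀ {X} → Closed X → ¬ T (X v) → Fort (Outside X)
    outside-fort {X} closed ¬Xv = record { member = u ; member∈F = inside vu ; guarded = guard }
      where
      inside : ∀ {x} → Adj v x → T (Outside X x)
      inside {x} vx = outside⁺ X x (λ Xx → ¬Xv (closed Xx (adj-sym G vx))) λ { refl → adj-irrefl G vx }
      guard : ∀ {y x} → ¬ T (Outside X y) → T (Outside X x) → Adj y x →
              ∃[ w' ] w' ≢ x × Adj y w' × T (Outside X w')
      guard {y} {x} ¬Fy Fx yx = from-v y≡v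
        where
        -- y is outside X, as X is closed and x is not in X; so y must be v
        y≡v : y ≡ v
        y≡v = decidable-stable (y ≟ v) λ y≢v →
          ¬Fy (outside⁺ X y (λ Xy → proj₁ (outside⁻ X x Fx) (closed Xy yx)) y≢v)
        from-v : y ≡ v → ∃[ w' ] w' ≢ x × Adj y w' × T (Outside X w')
        from-v refl with u ≟ x
        ... | yes refl = w , (λ w≡u → u≢w (sym w≡u)) , vw , inside vw
        ... | no u≢x   = u , u≢x , vu , inside vu

    -- So a closed set avoiding v can be enlarged by a nonempty closed set
    -- inside that fort, still avoiding v.
    enlarge : ∀ X → Closed X → ¬ T (X v) → ∃[ X' ] Closed X' × ¬ T (X' v) × size X < size X'
    enlarge X closed ¬Xv = add (fort-contains-closed (Outside X) (outside-fort closed ¬Xv))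
      where
      add : ∃[ Y ] Y ⊆ Outside X × NonEmpty Y × Closed Y → ∃[ X' ] Closed X' × ¬ T (X' v) × size X < size X'
      add (Y , Y⊆F , (y , Yy) , closedY) =
        X ∪ Y , ∪-closed closed closedY , avoids ,
        size-strict (λ x Xx → ∪⁺ X Y x (inj₁ Xx)) y (proj₁ (outside⁻ X y (Y⊆F y Yy))) (∪⁺ X Y y (inj₂ Yy))
        where
        avoids : ¬ T ((X ∪ Y) v)
        avoids XYv = [ ¬Xv , (λ Yv → proj₂ (outside⁻ X v (Y⊆F v Yv)) refl) ] (∪⁻ X Y v XYv)

    -- Iterating, closed sets avoiding v grow without bound, which is absurd.
    closed-avoiding : ∀ k → ∃[ X ] Closed X × ¬ T (X v) × k ≤ size X
    closed-avoiding zero    = (λ _ → false) , (λ ()) , (λ ()) , z≤n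
    closed-avoiding (suc k) =
      let X  , closed  , ¬Xv  , k≤size = closed-avoiding k
          X' , closed' , ¬X'v , size<  = enlarge X closed ¬Xv
      in  X' , closed' , ¬X'v , ≤-trans (s≤s k≤size) size<

    two-neighbours-impossible : ⊥
    two-neighbours-impossible =
      let X , _ , ¬Xv , n≤size = closed-avoiding n in ¬Xv (size-full X n≤size v)

  max-degree≤1 : MaxDegree≤1 G
  max-degree≤1 v u w vu vw =
    decidable-stable (u ≟ w) (λ u≢w → two-neighbours-impossible vu vw u≢w)

allSubsets-complete : ∀ n (S : Coloring n) → Any (_≗ S) (allSubsets n)
allSubsets-complete zero    S = here λ ()
allSubsets-complete (suc n) S with S zero in S₀ | allSubsets-complete n (S ∘ suc)
... | false | found = ++⁺ˡ (map⁺ (Any.map (λ S'≗ → λ { zero → sym S₀ ; (suc i) → S'≗ i }) found))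
... | true  | found = ++⁺ʳ _ (map⁺ (Any.map (λ S'≗ → λ { zero → sym S₀ ; (suc i) → S'≗ i }) found))

module Counting {n : ℕ} (G : Graph n) where
  open Forcing G
  open Forts G

  -- In a graph with a vertex x₀, every power dominating set is nonempty: if
  -- S is empty so is its closed neighbourhood, which then misses the fort of all vertices.
  pd-nonempty : Fin n → ∀ S → T (isPowerDominating G S) → 1 ≤ size S
  pd-nonempty x₀ S pd with any? (λ x → T? (S x))
  ... | yes (x , Sx) = ≤-trans (s≤s z≤n) (size-strict {c = λ _ → false} (λ _ ()) x (λ ()) Sx)
  ... | no  empty    = contradiction pd (fort-not-zf everything dominated-empty)
    where
    everything : Fort (λ _ → true)
    everything = record { member = x₀ ; member∈F = _ ; guarded = λ outside → contradiction _ outside }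
    dominated-empty : Disjoint (dominate G S) (λ _ → true)
    dominated-empty x h _ with dominate⁻ {S} h
    ... | inj₁ Sx           = empty (x , Sx)
    ... | inj₂ (u , Su , _) = empty (u , Su)

  of-size : ∀ i {P Q : Coloring n → Bool} → (∀ S → T (P S) → T (Q S)) →
            ∀ S → T (P S ∧ (size S ≡ᵇ i)) → T (Q S ∧ (size S ≡ᵇ i))
  of-size i P⇒Q S h = let PS , sized = Equivalence.to T-∧ h in Equivalence.from T-∧ (P⇒Q S PS , sized)

  -- As zero forcing sets are power dominating, a power
  -- dominating set S of size i that is not zero forcing makes z(G;i) < p(G;i);
  -- here S is found in allSubsets up to pointwise equality.
  z≡p⇒pd⇒zf : Fin n → (∀ i → 1 ≤ i → i ≤ n → z G i ≡ p G i) →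
              ∀ S → T (isPowerDominating G S) → T (isZeroForcing G S)
  z≡p⇒pd⇒zf x₀ z≡p S pd = decidable-stable (T? (isZeroForcing G S)) λ ¬zf →
    <-irrefl (z≡p i (pd-nonempty x₀ S pd) (size-≤ S))
             (count-strict (of-size i zf⇒pd) (Any.map (witness ¬zf) (allSubsets-complete n S)))
    where
    i : ℕ
    i = size S
    witness : ¬ T (isZeroForcing G S) → ∀ {S'} → S' ≗ S →
              ¬ T (isZeroForcing G S' ∧ (size S' ≡ᵇ i)) × T (isPowerDominating G S' ∧ (size S' ≡ᵇ i))
    witness ¬zf {S'} S'≗S =
      (λ h → ¬zf (zf-mono S'⊆S (proj₁ (Equivalence.to T-∧ h)))) ,
      Equivalence.from T-∧ (pd-mono S⊆S' pd , ≡⇒≡ᵇ _ _ (≤-antisym (size-mono S'⊆S) (size-mono S⊆S')))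
      where
      S'⊆S : S' ⊆ S
      S'⊆S x = subst T (S'≗S x)
      S⊆S' : S ⊆ S'
      S⊆S' x = subst T (sym (S'≗S x))

  pd⇒zf⇒z≡p : (∀ S → T (isPowerDominating G S) → T (isZeroForcing G S)) → ∀ i → z G i ≡ p G i
  pd⇒zf⇒z≡p pd⇒zf i = ≤-antisym (count-mono (of-size i zf⇒pd) (allSubsets n))
                                 (count-mono (of-size i pd⇒zf) (allSubsets n))

module _ {m k} (G : Graph m) (H : Graph k) where

  ≅-from-inverse : (f : Fin m ↔ Fin k) →
                   (∀ y y' → adj H y y' ≡ adj G (Inverse.from f y) (Inverse.from f y')) → G ≅ H
  ≅-from-inverse f preserves = f , λ i j → begin
    adj G i j
      ≡⟨ cong₂ (adj G) (sym (strictlyInverseʳ f i)) (sym (strictlyInverseʳ f j)) ⟩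
    adj G (from f (to f i)) (from f (to f j))
      ≡⟨ preserves (to f i) (to f j) ⟨
    adj H (to f i) (to f j) ∎
    where open ≡-Reasoning
          open Inverse

  ≅-max-degree≤1 : G ≅ H → MaxDegree≤1 H → MaxDegree≤1 G
  ≅-max-degree≤1 (f , preserves) deg v u w vu vw = Injection.injective (Inverse⇒Injection f)
    (deg _ _ _ (subst T (preserves v u) vu) (subst T (preserves v w) vw))

≅-refl : ∀ {n} {G : Graph n} → G ≅ G
≅-refl = ↔-refl , λ i j → refl

≅-trans : ∀ {a b c} {G : Graph a} {H : Graph b} {K : Graph c} → G ≅ H → H ≅ K → G ≅ K
≅-trans (f , pf) (g , pg) = ↔-trans f g , λ i j → trans (pf i j) (pg _ _)

adjSum : ∀ {m k} → Graph m → Graph k → Fin m ⊎ Fin k → Fin m ⊎ Fin k → Bool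
adjSum G H (inj₁ x) (inj₁ y) = adj G x y
adjSum G H (inj₂ x) (inj₂ y) = adj H x y
adjSum G H _        _        = false

adj-⊍ : ∀ {m k} (G : Graph m) (H : Graph k) i j → adj (G ⊍ H) i j ≡ adjSum G H (splitAt m i) (splitAt m j)
adj-⊍ {m} G H i j with splitAt m i | splitAt m j
... | inj₁ _ | inj₁ _ = refl
... | inj₁ _ | inj₂ _ = refl
... | inj₂ _ | inj₁ _ = refl
... | inj₂ _ | inj₂ _ = refl

adj-⊍-join : ∀ {m k} (G : Graph m) (H : Graph k) a b → adj (G ⊍ H) (join m k a) (join m k b) ≡ adjSum G H a b
adj-⊍-join {m} {k} G H a b = trans (adj-⊍ G H _ _) (cong₂ (adjSum G H) (splitAt-join m k a) (splitAt-join m k b))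

≅-⊍ : ∀ {m k m' k'} {G : Graph m} {H : Graph k} {G' : Graph m'} {H' : Graph k'} →
      G ≅ G' → H ≅ H' → (G ⊍ H) ≅ (G' ⊍ H')
≅-⊍ {m} {k} {m'} {k'} {G} {H} {G'} {H'} (f , pf) (g , pg) =
  ↔-trans +↔⊎ (↔-trans (f ⊎-↔ g) (↔-sym +↔⊎)) , λ i j → begin
    adj (G ⊍ H) i j
      ≡⟨ adj-⊍ G H i j ⟩
    adjSum G H (splitAt m i) (splitAt m j)
      ≡⟨ on-summands (splitAt m i) (splitAt m j) ⟩
    adjSum G' H' (both (splitAt m i)) (both (splitAt m j))
      ≡⟨ adj-⊍-join G' H' (both (splitAt m i)) (both (splitAt m j)) ⟨
    adj (G' ⊍ H') (join m' k' (both (splitAt m i))) (join m' k' (both (splitAt m j))) ∎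
  where
  open ≡-Reasoning
  both : Fin m ⊎ Fin k → Fin m' ⊎ Fin k'
  both = Sum.map (Inverse.to f) (Inverse.to g)
  on-summands : ∀ a b → adjSum G H a b ≡ adjSum G' H' (both a) (both b)
  on-summands (inj₁ x) (inj₁ y) = pf x y
  on-summands (inj₁ x) (inj₂ y) = refl
  on-summands (inj₂ x) (inj₁ y) = refl
  on-summands (inj₂ x) (inj₂ y) = pg x y

⊍-max-degree≤1 : ∀ {m k} (G : Graph m) (H : Graph k) → MaxDegree≤1 G → MaxDegree≤1 H → MaxDegree≤1 (G ⊍ H)
⊍-max-degree≤1 {m} {k} G H degG degH v u w vu vw =
  Injection.injective (Inverse⇒Injection (+↔⊎ {m} {k}))
    (on-summands (splitAt m v) (splitAt m u) (splitAt m w)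
                 (subst T (adj-⊍ G H v u) vu) (subst T (adj-⊍ G H v w) vw))
  where
  on-summands : ∀ a b c → T (adjSum G H a b) → T (adjSum G H a c) → b ≡ c
  on-summands (inj₁ x) (inj₁ y) (inj₁ z) xy xz = cong inj₁ (degG x y z xy xz)
  on-summands (inj₂ x) (inj₂ y) (inj₂ z) xy xz = cong inj₂ (degH x y z xy xz)
  on-summands (inj₁ x) (inj₂ y) _        ()
  on-summands (inj₁ x) (inj₁ y) (inj₂ z) _  ()
  on-summands (inj₂ x) (inj₁ y) _        ()
  on-summands (inj₂ x) (inj₂ y) (inj₁ z) _  ()

P1-max-degree≤1 : MaxDegree≤1 (P 1)
P1-max-degree≤1 zero zero zero _ _ = refl

P2-max-degree≤1 : MaxDegree≤1 (P 2)
P2-max-degree≤1 zero       (suc zero) (suc zero) _ _  = refl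
P2-max-degree≤1 (suc zero) zero       zero       _ _  = refl
P2-max-degree≤1 zero       zero       _          () _
P2-max-degree≤1 zero       (suc zero) zero       _  ()
P2-max-degree≤1 (suc zero) (suc zero) _          () _
P2-max-degree≤1 (suc zero) zero       (suc zero) _  ()

ShortPathUnion : ∀ {n} → Graph n → Set
ShortPathUnion G = Σ (List ℕ) λ as → All (λ a → 1 ≤ a × a ≤ 2) as × (G ≅ pathsUnion as)

short-path-union⇒max-degree≤1 : ∀ {n} {G : Graph n} → ShortPathUnion G → MaxDegree≤1 G
short-path-union⇒max-degree≤1 {G = G} (as , short , iso) =
  ≅-max-degree≤1 G (pathsUnion as) iso (union as short)
  where
  union : ∀ as → All (λ a → 1 ≤ a × a ≤ 2) as → MaxDegree≤1 (pathsUnion as)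
  union [] [] ()
  union (1 ∷ as) ((_ , _) ∷ short) = ⊍-max-degree≤1 (P 1) (pathsUnion as) P1-max-degree≤1 (union as short)
  union (2 ∷ as) ((_ , _) ∷ short) = ⊍-max-degree≤1 (P 2) (pathsUnion as) P2-max-degree≤1 (union as short)
  union (0 ∷ as) (() ∷ _)
  union (suc (suc (suc _)) ∷ as) ((_ , s≤s (s≤s ())) ∷ _)

extend-short : ∀ {k} a (G : Graph (a + k)) (R : Graph k) → 1 ≤ a × a ≤ 2 →
               G ≅ (P a ⊍ R) → ShortPathUnion R → ShortPathUnion G
extend-short a G R a-short split (as , short , iso) =
  a ∷ as , a-short ∷ short ,
  ≅-trans {G = G} {H = P a ⊍ R} {K = P a ⊍ pathsUnion as} split
          (≅-⊍ {G = P a} {H = R} {G' = P a} {H' = pathsUnion as} (≅-refl {G = P a}) iso)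

delete : ∀ {n} → Graph (suc n) → Fin (suc n) → Graph n
delete G i = record
  { adj    = λ x y → adj G (punchIn i x) (punchIn i y)
  ; sym    = λ x y → Graph.sym G (punchIn i x) (punchIn i y)
  ; irrefl = λ x → irrefl G (punchIn i x) }

delete-max-degree≤1 : ∀ {n} (G : Graph (suc n)) i → MaxDegree≤1 G → MaxDegree≤1 (delete G i)
delete-max-degree≤1 G i deg v u w vu vw = punchIn-injective i u w (deg _ _ _ vu vw)

only-neighbour : ∀ {n} (G : Graph n) → MaxDegree≤1 G → ∀ {v u w} → T (adj G v u) → w ≢ u → adj G v w ≡ false
only-neighbour G deg vu w≢u = ¬T⇒false λ vw → w≢u (deg _ _ _ vw vu)

isolated-split : ∀ {n} (G : Graph (suc n)) → (∀ j → ¬ T (adj G zero j)) → G ≅ (P 1 ⊍ delete G zero)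
isolated-split G isolated = ↔-refl , preserves
  where
  preserves : ∀ i j → adj G i j ≡ adj (P 1 ⊍ delete G zero) i j
  preserves zero    zero    = irrefl G zero
  preserves zero    (suc j) = ¬T⇒false (isolated (suc j))
  preserves (suc i) zero    = trans (Graph.sym G (suc i) zero) (¬T⇒false (isolated (suc i)))
  preserves (suc i) (suc j) = refl

module EdgeSplit {m} (G : Graph (suc (suc m))) (deg : MaxDegree≤1 G) (k : Fin (suc m))
                 (edge : T (adj G zero (suc k))) where

  Rest : Graph m
  Rest = delete (delete G zero) k

  from : Fin (suc (suc m)) → Fin (suc (suc m))
  from zero          = zero
  from (suc zero)    = suc k
  from (suc (suc i)) = suc (punchIn k i)

  to : Fin (suc (suc m)) → Fin (suc (suc m))
  to zero    = zero
  to (suc x) with k ≟ x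
  ... | yes _   = suc zero
  ... | no k≢x = suc (suc (punchOut k≢x))

  to-from : ∀ y → to (from y) ≡ y
  to-from zero = refl
  to-from (suc zero) with k ≟ k
  ... | yes _   = refl
  ... | no k≢k = contradiction refl k≢k
  to-from (suc (suc i)) with k ≟ punchIn k i
  ... | yes k≡ = contradiction (sym k≡) (punchInᵢ≢i k i)
  ... | no _   = cong (λ (j : Fin m) → Fin.suc (Fin.suc j)) (trans (punchOut-cong k refl) (punchOut-punchIn k))

  from-to : ∀ x → from (to x) ≡ x
  from-to zero = refl
  from-to (suc x) with k ≟ x
  ... | yes refl = refl
  ... | no k≢x  = cong suc (punchIn-punchOut k≢x)

  zero-rest : ∀ i → adj G zero (suc (punchIn k i)) ≡ false
  zero-rest i = only-neighbour G deg edge (punchInᵢ≢i k i ∘ suc-injective)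

  k-rest : ∀ i → adj G (suc k) (suc (punchIn k i)) ≡ false
  k-rest i = only-neighbour G deg (adj-sym G edge) λ ()

  split : G ≅ (P 2 ⊍ Rest)
  split = ≅-from-inverse G (P 2 ⊍ Rest) (mk↔ₛ′ to from to-from from-to) preserves
    where
    preserves : ∀ y y' → adj (P 2 ⊍ Rest) y y' ≡ adj G (from y) (from y')
    preserves zero          zero          = sym (irrefl G zero)
    preserves zero          (suc zero)    = sym (Equivalence.to T-≡ edge)
    preserves (suc zero)    zero          = sym (Equivalence.to T-≡ (adj-sym G edge))
    preserves (suc zero)    (suc zero)    = sym (irrefl G (suc k))
    preserves zero          (suc (suc i)) = sym (zero-rest i)
    preserves (suc (suc i)) zero          = sym (trans (Graph.sym G _ zero) (zero-rest i))
    preserves (suc zero)    (suc (suc i)) = sym (k-rest i)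
    preserves (suc (suc i)) (suc zero)    = sym (trans (Graph.sym G _ (suc k)) (k-rest i))
    preserves (suc (suc i)) (suc (suc j)) = refl

max-degree≤1⇒short-path-union : ∀ n (G : Graph n) → MaxDegree≤1 G → ShortPathUnion G
max-degree≤1⇒short-path-union zero G deg = [] , [] , ↔-refl , λ ()
max-degree≤1⇒short-path-union (suc n) G deg with any? (λ j → T? (adj G zero j))
... | no isolated =
  extend-short 1 G (delete G zero) (s≤s z≤n , s≤s z≤n) (isolated-split G λ j e → isolated (j , e))
    (max-degree≤1⇒short-path-union n (delete G zero) (delete-max-degree≤1 G zero deg))
... | yes (zero , loop) = contradiction loop (adj-irrefl G)
max-degree≤1⇒short-path-union (suc zero) G deg | yes (suc () , _)
max-degree≤1⇒short-path-union (suc (suc m)) G deg | yes (suc k , edge) =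
  extend-short 2 G Rest (s≤s z≤n , s≤s (s≤s z≤n)) split
    (max-degree≤1⇒short-path-union m Rest (delete-max-degree≤1 (delete G zero) k (delete-max-degree≤1 G zero deg)))
  where open EdgeSplit G deg k edge

theorem12 : ∀ (n : ℕ) (G : Graph n) → 1 ≤ n →
    ((∀ i → 1 ≤ i → i ≤ n → z G i ≡ p G i)
      ⇔ Σ (List ℕ) (λ as → All (λ a → 1 ≤ a × a ≤ 2) as × (G ≅ pathsUnion as)))
theorem12 zero    G ()
theorem12 (suc m) G _  = mk⇔ equal-polynomials⇒short-paths short-paths⇒equal-polynomials
  where
  equal-polynomials⇒short-paths : (∀ i → 1 ≤ i → i ≤ suc m → z G i ≡ p G i) → ShortPathUnion G
  equal-polynomials⇒short-paths z≡p =
    max-degree≤1⇒short-path-union (suc m) G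
      (NoPowerDominationGain.max-degree≤1 G (Counting.z≡p⇒pd⇒zf G zero z≡p))

  short-paths⇒equal-polynomials : ShortPathUnion G → ∀ i → 1 ≤ i → i ≤ suc m → z G i ≡ p G i
  short-paths⇒equal-polynomials short i _ _ =
    Counting.pd⇒zf⇒z≡p G (Forcing.max-degree≤1⇒pd⇒zf G (short-path-union⇒max-degree≤1 {G = G} short)) i
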